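{- Let $m\in\mathbb{N}$ and let $A,B$ be finite sequences of positive integers. If $A$ and $B$ are $m$-palindromes, then the concatenation $ABA$ is an $m$-palindrome.
   Context: For a finite sequence $X=(x_0,\dots,x_n)$ of positive integers, $[X]$ denotes the value of the finite continued fraction $[x_0,\dots,x_n]$ and $\widetilde X=(x_n,\dots,x_0)$ its reversal. $X$ is an $m$-palindrome if $[X]=m[\widetilde X]$. Concatenation of sequences is written by juxtaposition. -}

module Defs where

open import Data.Nat using (ℕ; suc; zero; _<_)
open import Data.List using (List; []; _∷_)
open import Data.List.NonEmpty using (List⁺; _∷_; toList)
open import Data.List.Relation.Unary.All using (All)
open import Data.Rational using (ℚ; 0ℚ; _+_; _*_; 1/_; ≢-nonZero; _/_)
open import Data.Rational.Properties using (_≟_)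
open import Relation.Nullary using (yes; no)
open import Relation.Binary.PropositionalEquality using (_≡_)
import Data.Integer as ℤ
import Data.List.NonEmpty as L⁺

ℕtoℚ : ℕ → ℚ
ℕtoℚ n = ℤ.+ n / 1

-- Reciprocal, total: the 0 branch is never reached for continued fractions
-- of positive integers (all tails have value ≥ 1).
recip : ℚ → ℚ
recip q with q ≟ 0ℚ
... | yes _ = 0ℚ
... | no q≢0 = 1/_ q {{≢-nonZero q≢0}}

cfList : ℕ → List ℕ → ℚ
cfList x [] = ℕtoℚ x
cfList x (y ∷ ys) = ℕtoℚ x + recip (cfList y ys)

cf : List⁺ ℕ → ℚ
cf (x ∷ xs) = cfList x xs

Positive : List⁺ ℕ → Set
Positive X = All (0 <_) (toList X)

IsPalindrome : ℕ → List⁺ ℕ → Set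
IsPalindrome m X = cf X ≡ ℕtoℚ m * cf (L⁺.reverse X)

-- Writing [x₀, …, xₙ] = p / q, the continuant matrix (x₀ 1; 1 0) ⋯ (xₙ 1; 1 0) = (p r; q s)
-- has first column (p, q), and the matrix of the reversed sequence is its transpose, so
-- [X̃] = p / r.  Hence X is an m-palindrome iff r = m q.  This condition on the matrix M of A
-- and N of B is preserved by the product M N M (a polynomial identity), and M N M is the
-- matrix of ABA.
module Submission where

open import Data.Nat using (ℕ; suc; _+_; _*_; _<_; pred; s≤s; z≤n; >-nonZero)
import Data.Nat.Properties as ℕ
open import Data.Nat.Tactic.RingSolver using (solve-∀)
import Data.Integer as ℤ
import Data.Integer.Properties as ℤ
open import Data.Rational using (ℚ; mkℚ; 0ℚ; toℚᵘ)
import Data.Rational as ℚ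
open import Data.Rational.Properties
  using (toℚᵘ-homo-+; toℚᵘ-homo-*; toℚᵘ-fromℚᵘ; toℚᵘ-injective; toℚᵘ-cong)
import Data.Rational.Properties as ℚ
open import Data.Rational.Unnormalised using (ℚᵘ; mkℚᵘ; _≃_; *≡*)
import Data.Rational.Unnormalised as ℚᵘ
open import Data.Rational.Unnormalised.Properties using (≃-trans; ≃-sym; +-cong; *-cong)
open import Function.Bundles using (_⇔_; mk⇔; Equivalence)
open import Data.List using (List; []; _∷_; _++_; reverse; [_])
open import Data.List.Properties using (unfold-reverse)
open import Data.List.NonEmpty using (List⁺; _∷_; _⁺++⁺_; toList)
import Data.List.NonEmpty as List⁺
open import Data.List.Relation.Unary.All using (All; tabulate; lookup)
open import Data.List.Relation.Unary.All.Properties using (++⁺)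
open import Data.List.Relation.Unary.Any.Properties using (reverse⁻)
import Data.Vec as Vec
import Data.Vec.Properties as Vec
open import Relation.Binary.PropositionalEquality hiding ([_])
open import Relation.Nullary using (no)
open import Defs

record Mat : Set where
  constructor mat
  field
    m11 m12 m21 m22 : ℕ
open Mat

mat-cong : ∀ {a b c d a′ b′ c′ d′} → a ≡ a′ → b ≡ b′ → c ≡ c′ → d ≡ d′ →
           mat a b c d ≡ mat a′ b′ c′ d′
mat-cong refl refl refl refl = refl

infixl 7 _⊗_

_⊗_ : Mat → Mat → Mat
mat a b c d ⊗ mat e f g h = mat (a * e + b * g) (a * f + b * h) (c * e + d * g) (c * f + d * h)

identity : Mat
identity = mat 1 0 0 1

transpose : Mat → Mat
transpose (mat a b c d) = mat a c b d

⊗-assoc : ∀ M N P → M ⊗ N ⊗ P ≡ M ⊗ (N ⊗ P)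
⊗-assoc (mat a b c d) (mat e f g h) (mat i j k l) =
  mat-cong (entry a b e f g h i k) (entry a b e f g h j l) (entry c d e f g h i k) (entry c d e f g h j l)
  where
  entry : ∀ a b e f g h i k →
          (a * e + b * g) * i + (a * f + b * h) * k ≡ a * (e * i + f * k) + b * (g * i + h * k)
  entry = solve-∀

⊗-identityˡ : ∀ M → identity ⊗ M ≡ M
⊗-identityˡ (mat a b c d) = mat-cong (first a c) (first b d) (second a c) (second b d)
  where
  first : ∀ a c → 1 * a + 0 * c ≡ a
  first = solve-∀
  second : ∀ a c → 0 * a + 1 * c ≡ c
  second = solve-∀

⊗-identityʳ : ∀ M → M ⊗ identity ≡ M
⊗-identityʳ (mat a b c d) = mat-cong (first a b) (second a b) (first c d) (second c d)
  where
  first : ∀ a b → a * 1 + b * 0 ≡ a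
  first = solve-∀
  second : ∀ a b → a * 0 + b * 1 ≡ b
  second = solve-∀

transpose-⊗ : ∀ M N → transpose (M ⊗ N) ≡ transpose N ⊗ transpose M
transpose-⊗ (mat a b c d) (mat e f g h) = mat-cong (entry a b e g) (entry c d e g) (entry a b f h) (entry c d f h)
  where
  entry : ∀ a b e g → a * e + b * g ≡ e * a + g * b
  entry = solve-∀

IsPalindromicMatrix : ℕ → Mat → Set
IsPalindromicMatrix m M = m12 M ≡ m * m21 M

⊗-⊗-isPalindromic : ∀ m M N → IsPalindromicMatrix m M → IsPalindromicMatrix m N →
                    IsPalindromicMatrix m (M ⊗ N ⊗ M)
⊗-⊗-isPalindromic m (mat a .(m * c) c d) (mat e .(m * f) f g) refl refl = identity-MNM m a c d e f g
  where
  identity-MNM : ∀ m a c d e f g →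
    (a * e + m * c * f) * (m * c) + (a * (m * f) + m * c * g) * d
      ≡ m * ((c * e + d * f) * a + (c * (m * f) + d * g) * c)
  identity-MNM = solve-∀

digit : ℕ → Mat
digit x = mat x 1 1 0

digit-⊗ : ∀ x M → digit x ⊗ M ≡ mat (x * m11 M + m21 M) (x * m12 M + m22 M) (m11 M) (m12 M)
digit-⊗ x (mat a b c d) = mat-cong (first x a c) (first x b d) (second a c) (second b d)
  where
  first : ∀ x a c → x * a + 1 * c ≡ x * a + c
  first = solve-∀
  second : ∀ a c → 1 * a + 0 * c ≡ a
  second = solve-∀

continuant : List ℕ → Mat
continuant [] = identity
continuant (x ∷ xs) = digit x ⊗ continuant xs

continuant-++ : ∀ xs ys → continuant (xs ++ ys) ≡ continuant xs ⊗ continuant ys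
continuant-++ [] ys = sym (⊗-identityˡ (continuant ys))
continuant-++ (x ∷ xs) ys = begin
  digit x ⊗ continuant (xs ++ ys)          ≡⟨ cong (digit x ⊗_) (continuant-++ xs ys) ⟩
  digit x ⊗ (continuant xs ⊗ continuant ys) ≡⟨ ⊗-assoc (digit x) _ _ ⟨
  digit x ⊗ continuant xs ⊗ continuant ys   ∎
  where open ≡-Reasoning

continuant-reverse : ∀ xs → continuant (reverse xs) ≡ transpose (continuant xs)
continuant-reverse [] = refl
continuant-reverse (x ∷ xs) = begin
  continuant (reverse (x ∷ xs))                  ≡⟨ cong continuant (unfold-reverse x xs) ⟩
  continuant (reverse xs ++ [ x ])               ≡⟨ continuant-++ (reverse xs) [ x ] ⟩
  continuant (reverse xs) ⊗ (digit x ⊗ identity) ≡⟨ cong₂ _⊗_ (continuant-reverse xs) (⊗-identityʳ (digit x)) ⟩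
  transpose (continuant xs) ⊗ transpose (digit x) ≡⟨ transpose-⊗ (digit x) (continuant xs) ⟨
  transpose (digit x ⊗ continuant xs)            ∎
  where open ≡-Reasoning

-- a / c, meaningful only for 0 < c (for c = 0 it is a / 1).
ratio : ℕ → ℕ → ℚᵘ
ratio a c = mkℚᵘ (ℤ.+ a) (pred c)

cross⇒ratio-≃ : ∀ {a c a′ c′} → 0 < c → 0 < c′ → a * c′ ≡ a′ * c → ratio a c ≃ ratio a′ c′
cross⇒ratio-≃ {a} {suc c} {a′} {suc c′} _ _ eq =
  *≡* (trans (sym (ℤ.pos-* a (suc c′))) (trans (cong ℤ.+_ eq) (ℤ.pos-* a′ (suc c))))

ratio-≃⇒cross : ∀ {a c a′ c′} → 0 < c → 0 < c′ → ratio a c ≃ ratio a′ c′ → a * c′ ≡ a′ * c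
ratio-≃⇒cross {a} {suc c} {a′} {suc c′} _ _ (*≡* eq) =
  ℤ.+-injective (trans (ℤ.pos-* a (suc c′)) (trans eq (sym (ℤ.pos-* a′ (suc c)))))

toℚᵘ-ℕtoℚ : ∀ x → toℚᵘ (ℕtoℚ x) ≃ ratio x 1
toℚᵘ-ℕtoℚ x = toℚᵘ-fromℚᵘ (ratio x 1)

ℕ+ratio : ∀ x a c → 0 < c → ratio x 1 ℚᵘ.+ ratio a c ≃ ratio (x * c + a) c
ℕ+ratio x a (suc c) _ = *≡* (cong₂ ℤ._*_ numerator (sym (cong (λ k → ℤ.+ suc k) (ℕ.+-identityʳ c))))
  where
  numerator : ℤ.+ x ℤ.* ℤ.+ suc c ℤ.+ ℤ.+ a ℤ.* ℤ.+ 1 ≡ ℤ.+ (x * suc c + a)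
  numerator = trans (cong₂ ℤ._+_ (sym (ℤ.pos-* x (suc c))) (ℤ.*-identityʳ (ℤ.+ a)))
                    (sym (ℤ.pos-+ (x * suc c) a))

ℕ*ratio : ∀ m a c → 0 < c → ratio m 1 ℚᵘ.* ratio a c ≃ ratio (m * a) c
ℕ*ratio m a (suc c) _ =
  *≡* (cong₂ ℤ._*_ (sym (ℤ.pos-* m a)) (sym (cong (λ k → ℤ.+ suc k) (ℕ.+-identityʳ c))))

toℚᵘ-recip : ∀ q {a c} → 0 < a → 0 < c → toℚᵘ q ≃ ratio a c → toℚᵘ (recip q) ≃ ratio c a
toℚᵘ-recip (mkℚ (ℤ.+ 0) _ _) {suc a} {suc c} _ _ (*≡* ())
toℚᵘ-recip (mkℚ ℤ.-[1+ _ ] _ _) {suc a} {suc c} _ _ (*≡* ())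
toℚᵘ-recip q@(mkℚ ℤ.+[1+ n ] d _) {suc a} {suc c} _ _ (*≡* eq) with q ℚ.≟ 0ℚ
... | no _ = *≡* (trans (ℤ.*-comm (ℤ.+ suc d) (ℤ.+ suc a)) (trans (sym eq) (ℤ.*-comm (ℤ.+ suc n) (ℤ.+ suc c))))

record FirstColumnRatio (M : Mat) (q : ℚ) : Set where
  constructor firstColumnRatio
  field
    m11-positive : 0 < m11 M
    m21-positive : 0 < m21 M
    toℚᵘ≃ratio   : toℚᵘ q ≃ ratio (m11 M) (m21 M)
open FirstColumnRatio

digit-firstColumnRatio : ∀ {x} → 0 < x → FirstColumnRatio (digit x) (ℕtoℚ x)
digit-firstColumnRatio {x} 0<x = firstColumnRatio 0<x (s≤s z≤n) (toℚᵘ-ℕtoℚ x)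

digit-⊗-firstColumnRatio : ∀ x {M q} → FirstColumnRatio M q →
                           FirstColumnRatio (digit x ⊗ M) (ℕtoℚ x ℚ.+ recip q)
digit-⊗-firstColumnRatio x {M} {q} (firstColumnRatio 0<a 0<c q≃a/c) =
  subst (λ N → FirstColumnRatio N (ℕtoℚ x ℚ.+ recip q)) (sym (digit-⊗ x M))
    (firstColumnRatio (ℕ.<-≤-trans 0<c (ℕ.m≤n+m _ _)) 0<a value)
  where
  value : toℚᵘ (ℕtoℚ x ℚ.+ recip q) ≃ ratio (x * m11 M + m21 M) (m11 M)
  value = ≃-trans (toℚᵘ-homo-+ (ℕtoℚ x) (recip q))
    (≃-trans (+-cong (toℚᵘ-ℕtoℚ x) (toℚᵘ-recip q 0<a 0<c q≃a/c)) (ℕ+ratio x _ _ 0<a))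

cfList-firstColumnRatio : ∀ x xs → All (0 <_) (x ∷ xs) → FirstColumnRatio (continuant (x ∷ xs)) (cfList x xs)
cfList-firstColumnRatio x [] (0<x All.∷ _) =
  subst (λ N → FirstColumnRatio N (ℕtoℚ x)) (sym (⊗-identityʳ (digit x))) (digit-firstColumnRatio 0<x)
cfList-firstColumnRatio x (y ∷ ys) (_ All.∷ pos) =
  digit-⊗-firstColumnRatio x (cfList-firstColumnRatio y ys pos)

cf-firstColumnRatio : ∀ X → Positive X → FirstColumnRatio (continuant (toList X)) (cf X)
cf-firstColumnRatio (x ∷ xs) = cfList-firstColumnRatio x xs

toList-fromVec : ∀ {A : Set} {n} (v : Vec.Vec A (suc n)) → toList (List⁺.fromVec v) ≡ Vec.toList v
toList-fromVec (x Vec.∷ v) = refl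

toList-reverse : ∀ (X : List⁺ ℕ) → toList (List⁺.reverse X) ≡ reverse (toList X)
toList-reverse (x ∷ xs) = begin
  toList (List⁺.reverse (x ∷ xs))                    ≡⟨ toList-fromVec (Vec.reverse (x Vec.∷ Vec.fromList xs)) ⟩
  Vec.toList (Vec.reverse (x Vec.∷ Vec.fromList xs)) ≡⟨ Vec.toList-reverse (x Vec.∷ Vec.fromList xs) ⟩
  reverse (x ∷ Vec.toList (Vec.fromList xs))         ≡⟨ cong (λ l → reverse (x ∷ l)) (Vec.toList∘fromList xs) ⟩
  reverse (x ∷ xs)                                   ∎
  where open ≡-Reasoning

positive-reverse : ∀ X → Positive X → Positive (List⁺.reverse X)
positive-reverse X pos =
  subst (All (0 <_)) (sym (toList-reverse X)) (tabulate (λ x∈ → lookup pos (reverse⁻ x∈)))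

cf-reverse-firstColumnRatio : ∀ X → Positive X →
  FirstColumnRatio (transpose (continuant (toList X))) (cf (List⁺.reverse X))
cf-reverse-firstColumnRatio X pos =
  subst (λ N → FirstColumnRatio N (cf (List⁺.reverse X)))
    (trans (cong continuant (toList-reverse X)) (continuant-reverse (toList X)))
    (cf-firstColumnRatio (List⁺.reverse X) (positive-reverse X pos))

module _ (m : ℕ) {M : Mat} {q q̃ : ℚ}
         (q≈M : FirstColumnRatio M q) (q̃≈Mᵀ : FirstColumnRatio (transpose M) q̃) where

  private
    0<a : 0 < m11 M
    0<a = m11-positive q≈M
    0<c : 0 < m21 M
    0<c = m21-positive q≈M
    0<b : 0 < m12 M
    0<b = m21-positive q̃≈Mᵀ

    mq̃≃ma/b : toℚᵘ (ℕtoℚ m ℚ.* q̃) ≃ ratio (m * m11 M) (m12 M)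
    mq̃≃ma/b = ≃-trans (toℚᵘ-homo-* (ℕtoℚ m) q̃)
      (≃-trans (*-cong (toℚᵘ-ℕtoℚ m) (toℚᵘ≃ratio q̃≈Mᵀ)) (ℕ*ratio m _ _ 0<b))

    reassoc : ∀ m a c → m * a * c ≡ a * (m * c)
    reassoc = solve-∀

    ratio-palindrome⇒ : q ≡ ℕtoℚ m ℚ.* q̃ → IsPalindromicMatrix m M
    ratio-palindrome⇒ q≡mq̃ =
      ℕ.*-cancelˡ-≡ (m12 M) (m * m21 M) (m11 M) {{>-nonZero 0<a}}
        (trans (ratio-≃⇒cross 0<c 0<b a/c≃ma/b) (reassoc m (m11 M) (m21 M)))
      where
      a/c≃ma/b : ratio (m11 M) (m21 M) ≃ ratio (m * m11 M) (m12 M)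
      a/c≃ma/b = ≃-trans (≃-sym (toℚᵘ≃ratio q≈M)) (≃-trans (toℚᵘ-cong q≡mq̃) mq̃≃ma/b)

    ratio-palindrome⇐ : IsPalindromicMatrix m M → q ≡ ℕtoℚ m ℚ.* q̃
    ratio-palindrome⇐ b≡mc = toℚᵘ-injective
      (≃-trans (toℚᵘ≃ratio q≈M)
        (≃-trans (cross⇒ratio-≃ 0<c 0<b cross) (≃-sym mq̃≃ma/b)))
      where
      cross : m11 M * m12 M ≡ m * m11 M * m21 M
      cross = trans (cong (m11 M *_) b≡mc) (sym (reassoc m (m11 M) (m21 M)))

  ratio-palindrome⇔ : q ≡ ℕtoℚ m ℚ.* q̃ ⇔ IsPalindromicMatrix m M
  ratio-palindrome⇔ = mk⇔ ratio-palindrome⇒ ratio-palindrome⇐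

isPalindrome⇔isPalindromicMatrix : ∀ m X → Positive X →
  IsPalindrome m X ⇔ IsPalindromicMatrix m (continuant (toList X))
isPalindrome⇔isPalindromicMatrix m X pos =
  ratio-palindrome⇔ m (cf-firstColumnRatio X pos) (cf-reverse-firstColumnRatio X pos)

lemma3p9 : (m : ℕ) (A B : List⁺ ℕ) → Positive A → Positive B →
    IsPalindrome m A → IsPalindrome m B → IsPalindrome m (A ⁺++⁺ B ⁺++⁺ A)
lemma3p9 m A B pA pB hA hB =
  from (palindrome⇔ (A ⁺++⁺ B ⁺++⁺ A) (++⁺ pA (++⁺ pB pA)))
    (subst (IsPalindromicMatrix m) (sym continuant-ABA)
      (⊗-⊗-isPalindromic m _ _ (to (palindrome⇔ A pA) hA) (to (palindrome⇔ B pB) hB)))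
  where
  open Equivalence
  palindrome⇔ : ∀ X → Positive X → IsPalindrome m X ⇔ IsPalindromicMatrix m (continuant (toList X))
  palindrome⇔ = isPalindrome⇔isPalindromicMatrix m
  a b : List ℕ
  a = toList A
  b = toList B
  continuant-ABA : continuant (a ++ b ++ a) ≡ continuant a ⊗ continuant b ⊗ continuant a
  continuant-ABA = begin
    continuant (a ++ b ++ a)                      ≡⟨ continuant-++ a (b ++ a) ⟩
    continuant a ⊗ continuant (b ++ a)            ≡⟨ cong (continuant a ⊗_) (continuant-++ b a) ⟩
    continuant a ⊗ (continuant b ⊗ continuant a)  ≡⟨ ⊗-assoc (continuant a) (continuant b) (continuant a) ⟨
    continuant a ⊗ continuant b ⊗ continuant a    ∎
    where open ≡-Reasoning
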